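{- Let $\mathbf A$ be an SBP-algebra and let $\mathfrak x$ be a generalized prime filter of $\mathcal R(\mathbf A)$. For $u\in\mathcal B(\mathbf A)$ set $\mu_u(\mathfrak x)=\{x\in\mathcal R(\mathbf A):u\vee x\in\mathfrak x\}$. Then for all $u,v\in\mathcal B(\mathbf A)$: 1. $\mu_{u\vee v}(\mathfrak x)$ is one of $\mu_u(\mathfrak x)$ or $\mu_v(\mathfrak x)$; 2. $\mu_{u\wedge v}(\mathfrak x)$ is one of $\mu_u(\mathfrak x)$ or $\mu_v(\mathfrak x)$; 3. $\mu_u(\mathfrak x)=\mathfrak x$ or $\mu_{\neg u}(\mathfrak x)=\mathfrak x$; 4. $\mu_u(\mathfrak x)=\mathfrak x$ or $\mu_u(\mathfrak x)=\mathcal R(\mathbf A)$; 5. $\mu_u(\mu_u(\mathfrak x))=\mu_u(\mathfrak x)$.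
   Context: **SBP-algebras.** An MTL-algebra is a bounded commutative integral residuated lattice $(A,\wedge,\vee,\cdot,\to,0,1)$ with distributive lattice reduct satisfying $(a\to b)\vee(b\to a)=1$. Write $\neg a=a\to0$. An SBP-algebra is an MTL-algebra satisfying $\neg(a^2)\to(\neg\neg a\to a)=1$ and $(2a)^2=2(a^2)$, where $a^2=a\cdot a$ and $2a=\neg(\neg a\cdot\neg a)$. **Notation.** - The radical $\mathcal R(\mathbf A)=\{x:\neg x<x\}$ is an up-set sublattice. - The Boolean skeleton is $\mathcal B(\mathbf A)=\{u:u\vee\neg u=1\}$. - A generalized prime filter of $\mathcal R(\mathbf A)$ is either a proper lattice filter $F$ of $\mathcal R(\mathbf A)$ with $a\vee b\in F\Rightarrow a\in F$ or $b\in F$, or $\mathcal R(\mathbf A)$ itself. -}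

module Defs where

open import Level using (Level; suc; _⊔_)
open import Relation.Binary.PropositionalEquality using (_≡_; _≢_)
open import Data.Product using (_×_; ∃)
open import Data.Sum using (_⊎_)
open import Relation.Nullary using (¬_)

record MTLAlgebra (a : Level) : Set (suc a) where
  infixr 5 _⇒_
  infixl 7 _·_
  infixl 6 _∧_
  infixl 5 _∨_
  field
    Carrier : Set a
    _∧_ _∨_ _·_ _⇒_ : Carrier → Carrier → Carrier
    𝟘 𝟙 : Carrier
    ∧-comm   : ∀ x y → x ∧ y ≡ y ∧ x
    ∨-comm   : ∀ x y → x ∨ y ≡ y ∨ x
    ∧-assoc  : ∀ x y z → (x ∧ y) ∧ z ≡ x ∧ (y ∧ z)
    ∨-assoc  : ∀ x y z → (x ∨ y) ∨ z ≡ x ∨ (y ∨ z)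
    ∧-absorb : ∀ x y → x ∧ (x ∨ y) ≡ x
    ∨-absorb : ∀ x y → x ∨ (x ∧ y) ≡ x
    ∧-distrib-∨ : ∀ x y z → x ∧ (y ∨ z) ≡ (x ∧ y) ∨ (x ∧ z)
    𝟘-least  : ∀ x → 𝟘 ∧ x ≡ 𝟘
    𝟙-greatest : ∀ x → x ∧ 𝟙 ≡ x
    -- commutative monoid with unit 𝟙 (integrality: 𝟙 is the top)
    ·-comm   : ∀ x y → x · y ≡ y · x
    ·-assoc  : ∀ x y z → (x · y) · z ≡ x · (y · z)
    ·-identity : ∀ x → x · 𝟙 ≡ x
    -- residuation (x ≤ y means x ∧ y ≡ x)
    residuated₁ : ∀ x y z → (x · y) ∧ z ≡ x · y → x ∧ (y ⇒ z) ≡ x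
    residuated₂ : ∀ x y z → x ∧ (y ⇒ z) ≡ x → (x · y) ∧ z ≡ x · y
    prelinear : ∀ x y → (x ⇒ y) ∨ (y ⇒ x) ≡ 𝟙

  _≤_ : Carrier → Carrier → Set a
  x ≤ y = x ∧ y ≡ x

  _<_ : Carrier → Carrier → Set a
  x < y = (x ≤ y) × (x ≢ y)

  ¬ₐ_ : Carrier → Carrier
  ¬ₐ x = x ⇒ 𝟘

  sq : Carrier → Carrier
  sq x = x · x

  dbl : Carrier → Carrier
  dbl x = ¬ₐ ((¬ₐ x) · (¬ₐ x))

record SBPAlgebra (a : Level) : Set (suc a) where
  field
    mtl : MTLAlgebra a
  open MTLAlgebra mtl public
  field
    sbp₁ : ∀ x → (¬ₐ (sq x)) ⇒ ((¬ₐ (¬ₐ x)) ⇒ x) ≡ 𝟙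
    sbp₂ : ∀ x → sq (dbl x) ≡ dbl (sq x)

module SBPNotions {a : Level} (A : SBPAlgebra a) where
  open SBPAlgebra A

  Subset : Set (suc a)
  Subset = Carrier → Set a

  _≐_ : Subset → Subset → Set a
  P ≐ Q = ∀ x → (P x → Q x) × (Q x → P x)

  Rad : Subset
  Rad x = (¬ₐ x) < x

  Bool : Subset
  Bool u = u ∨ (¬ₐ u) ≡ 𝟙

  record IsProperPrimeFilterOfRad (F : Subset) : Set a where
    field
      ⊆Rad     : ∀ x → F x → Rad x
      nonempty : ∃ λ x → F x
      up-closed : ∀ x y → F x → Rad y → x ≤ y → F y
      ∧-closed : ∀ x y → F x → F y → F (x ∧ y)
      proper   : ∃ λ x → Rad x × ¬ F x
      prime    : ∀ x y → Rad x → Rad y → F (x ∨ y) → F x ⊎ F y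

  IsGenPrimeFilter : Subset → Set a
  IsGenPrimeFilter F = IsProperPrimeFilterOfRad F ⊎ (F ≐ Rad)

  μ : Carrier → Subset → Subset
  μ u X x = Rad x × X (u ∨ x)

{-# OPTIONS --safe #-}
-- The core is a dichotomy for a complementary pair p, q (p ∨ q = 1 and
-- p ∧ q ≤ 0) and a proper prime filter F of R(A). Pick x₀ ∈ R(A) outside F;
-- since (p ∨ x₀) ∨ (q ∨ x₀) = 1, primeness puts p ∨ x₀ or q ∨ x₀ in F. If
-- q ∨ x₀ ∈ F, then p ∨ x ∈ F gives (p ∨ x) ∧ (q ∨ x₀) ≤ x ∨ x₀ in F, so x ∈ F
-- by primeness: μ_p(F) = F. Otherwise μ_q(F) = F symmetrically, and then
-- μ_p(F) = R(A) because q ∨ (p ∨ x) = 1. For Boolean u the pair u, ¬u gives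
-- items 3 and 4; items 1 and 2 follow since u ↦ μ_u(F) is monotone, and
-- μ_u(R(A)) = R(A) settles the remaining case.
module Submission where

open import Defs
open import Level using (Level)
open import Function.Base using (flip)
open import Data.Product using (_×_; _,_; proj₁; proj₂)
open import Data.Sum as Sum using (_⊎_; inj₁; inj₂; fromInj₁)
open import Relation.Nullary using (¬_; contradiction)
open import Relation.Unary using (_⊆_)
open import Relation.Binary.PropositionalEquality
  using (_≡_; sym; trans; cong; cong₂; subst; isEquivalence; module ≡-Reasoning)
import Relation.Binary.Construct.Flip.EqAndOrd as Flip
open import Algebra.Lattice.Bundles using (Lattice)
import Algebra.Lattice.Properties.Lattice as LatticeProperties
import Relation.Binary.Lattice as Order
import Relation.Binary.Lattice.Properties.JoinSemilattice as JoinSemilatticeProperties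
import Relation.Binary.Lattice.Properties.MeetSemilattice as MeetSemilatticeProperties
import Relation.Binary.Lattice.Properties.DistributiveLattice as DistributiveLatticeProperties

module MTLOrder {a : Level} (M : MTLAlgebra a) where
  open MTLAlgebra M

  -- With equality flipped, the library's natural order x ≈ x ∧ y is
  -- literally the order x ∧ y ≡ x of MTLAlgebra.
  lattice : Lattice a a
  lattice = record
    { _≈_       = flip _≡_
    ; _∨_       = _∨_
    ; _∧_       = _∧_
    ; isLattice = record
      { isEquivalence = Flip.isEquivalence isEquivalence
      ; ∨-comm        = λ x y → sym (∨-comm x y)
      ; ∨-assoc       = λ x y z → sym (∨-assoc x y z)
      ; ∨-cong        = cong₂ _∨_
      ; ∧-comm        = λ x y → sym (∧-comm x y)
      ; ∧-assoc       = λ x y z → sym (∧-assoc x y z)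
      ; ∧-cong        = cong₂ _∧_
      ; absorptive    = (λ x y → sym (∨-absorb x y)) , (λ x y → sym (∧-absorb x y))
      }
    }

  distributiveLattice : Order.DistributiveLattice a a a
  distributiveLattice = record
    { isDistributiveLattice = record
      { isLattice    = LatticeProperties.∨-∧-isOrderTheoreticLattice lattice
      ; ∧-distribˡ-∨ = λ x y z → sym (∧-distrib-∨ x y z)
      }
    }

  open Order.DistributiveLattice distributiveLattice public
    using (x≤x∨y; y≤x∨y; ∨-least; x∧y≤x; x∧y≤y)
    renaming (refl to ≤-refl; reflexive to ≤-reflexive; trans to ≤-trans; antisym to ≤-antisym)
  open JoinSemilatticeProperties (Order.DistributiveLattice.joinSemilattice distributiveLattice)
    public using (∨-monotonic; ∨-idempotent)
  open MeetSemilatticeProperties (Order.DistributiveLattice.meetSemilattice distributiveLattice)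
    public using (∧-monotonic)
  open DistributiveLatticeProperties distributiveLattice using (∨-distribˡ-∧)

  ∨∧∨-≤ : ∀ p q x y → ((p ∨ x) ∧ (q ∨ y)) ≤ ((x ∨ y) ∨ (p ∧ q))
  ∨∧∨-≤ p q x y = ≤-trans
    (∧-monotonic (∨-least (y≤x∨y (x ∨ y) p) (≤-trans (x≤x∨y x y) (x≤x∨y (x ∨ y) p)))
                 (∨-least (y≤x∨y (x ∨ y) q) (≤-trans (y≤x∨y x y) (x≤x∨y (x ∨ y) q))))
    (≤-reflexive (sym (∨-distribˡ-∧ (x ∨ y) p q)))

  ·-distribʳ-∨-≤ : ∀ c x y → ((x ∨ y) · c) ≤ (x · c ∨ y · c)
  ·-distribʳ-∨-≤ c x y = residuated₂ (x ∨ y) c (x · c ∨ y · c) (∨-least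
    (residuated₁ x c (x · c ∨ y · c) (x≤x∨y (x · c) (y · c)))
    (residuated₁ y c (x · c ∨ y · c) (y≤x∨y (x · c) (y · c))))

  ≤¬-swap : ∀ {x y} → x ≤ (¬ₐ y) → y ≤ (¬ₐ x)
  ≤¬-swap {x} {y} x≤¬y = residuated₁ y x 𝟘
    (subst (_≤ 𝟘) (·-comm x y) (residuated₂ x y 𝟘 x≤¬y))

  ≤¬¬ : ∀ x → x ≤ (¬ₐ (¬ₐ x))
  ≤¬¬ x = ≤¬-swap ≤-refl

  ¬-antitone : ∀ {x y} → x ≤ y → (¬ₐ y) ≤ (¬ₐ x)
  ¬-antitone {x} {y} x≤y = ≤¬-swap (≤-trans x≤y (≤¬¬ y))

  complement-disjoint : ∀ {u} → u ∨ ¬ₐ u ≡ 𝟙 → (u ∧ ¬ₐ u) ≤ 𝟘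
  complement-disjoint {u} u∨¬u≡𝟙 = subst (_≤ 𝟘) (sym c≡[u∨¬u]·c)
    (≤-trans (·-distribʳ-∨-≤ c u (¬ₐ u))
      (∨-least (residuated₂ u c 𝟘 (≤¬-swap (x∧y≤y u (¬ₐ u))))
               (residuated₂ (¬ₐ u) c 𝟘 (≤¬-swap (≤-trans (x∧y≤x u (¬ₐ u)) (≤¬¬ u))))))
    where
      c : Carrier
      c = u ∧ ¬ₐ u
      open ≡-Reasoning
      c≡[u∨¬u]·c : c ≡ (u ∨ ¬ₐ u) · c
      c≡[u∨¬u]·c = begin
        c                ≡⟨ sym (·-identity c) ⟩
        c · 𝟙            ≡⟨ ·-comm c 𝟙 ⟩
        𝟙 · c            ≡⟨ cong (_· c) (sym u∨¬u≡𝟙) ⟩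
        (u ∨ ¬ₐ u) · c   ∎

module RadicalFilters {a : Level} (A : SBPAlgebra a) where
  open SBPAlgebra A
  open SBPNotions A
  open MTLOrder mtl

  Rad-upward : ∀ {x y} → x ≤ y → Rad x → Rad y
  Rad-upward {x} {y} x≤y (¬x≤x , ¬x≢x) =
    ≤-trans ¬y≤¬x (≤-trans ¬x≤x x≤y) ,
    λ ¬y≡y → ¬x≢x (≤-antisym (≤-trans x≤y (subst (_≤ (¬ₐ x)) ¬y≡y ¬y≤¬x)) ¬x≤x)
    where
      ¬y≤¬x : (¬ₐ y) ≤ (¬ₐ x)
      ¬y≤¬x = ¬-antitone x≤y

  ⊆-antisym : ∀ {P Q : Subset} → P ⊆ Q → Q ⊆ P → P ≐ Q
  ⊆-antisym P⊆Q Q⊆P _ = P⊆Q , Q⊆P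

  μ-idempotent : ∀ u X → μ u (μ u X) ≐ μ u X
  μ-idempotent u X = ⊆-antisym
    (λ { (x∈Rad , _ , u∨[u∨x]∈X) → x∈Rad , subst X u∨[u∨x]≡u∨x u∨[u∨x]∈X })
    (λ { {x} (x∈Rad , u∨x∈X) →
           x∈Rad , Rad-upward (y≤x∨y u x) x∈Rad , subst X (sym u∨[u∨x]≡u∨x) u∨x∈X })
    where
      u∨[u∨x]≡u∨x : ∀ {x} → u ∨ (u ∨ x) ≡ u ∨ x
      u∨[u∨x]≡u∨x {x} = trans (sym (∨-assoc u u x)) (cong (_∨ x) (sym (∨-idempotent u)))

  module RadicalItself {X : Subset} (X≐Rad : X ≐ Rad) where

    μ⊆X : ∀ {w} → μ w X ⊆ X
    μ⊆X {x = x} (x∈Rad , _) = proj₂ (X≐Rad x) x∈Rad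

    X⊆μ : ∀ {w} → X ⊆ μ w X
    X⊆μ {w} {x} x∈X = x∈Rad , proj₂ (X≐Rad (w ∨ x)) (Rad-upward (y≤x∨y w x) x∈Rad)
      where
        x∈Rad : Rad x
        x∈Rad = proj₁ (X≐Rad x) x∈X

    μ-fixes : ∀ {w} → μ w X ≐ X
    μ-fixes = ⊆-antisym μ⊆X X⊆μ

    μ-constant : ∀ {w w′} → μ w X ≐ μ w′ X
    μ-constant = ⊆-antisym (λ h → X⊆μ (μ⊆X h)) (λ h → X⊆μ (μ⊆X h))

  module ProperPrimeFilter {F : Subset} (F-isFilter : IsProperPrimeFilterOfRad F) where
    open IsProperPrimeFilterOfRad F-isFilter

    upward : ∀ {x y} → F x → x ≤ y → F y
    upward {x} {y} x∈F x≤y = up-closed x y x∈F (Rad-upward x≤y (⊆Rad x x∈F)) x≤y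

    𝟙≤⇒∈F : ∀ {z} → 𝟙 ≤ z → F z
    𝟙≤⇒∈F {z} 𝟙≤z = upward (proj₂ nonempty) (≤-trans (𝟙-greatest (proj₁ nonempty)) 𝟙≤z)

    μ-monotone : ∀ {w w′} → w ≤ w′ → μ w F ⊆ μ w′ F
    μ-monotone {w} {w′} w≤w′ {x} (x∈Rad , w∨x∈F) =
      x∈Rad , upward w∨x∈F (∨-monotonic w≤w′ (≤-refl {x}))

    F⊆μ : ∀ {w} → F ⊆ μ w F
    F⊆μ {w} {x} x∈F = ⊆Rad x x∈F , upward x∈F (y≤x∨y w x)

    μ⊆F-of-disjoint : ∀ {p q x₀} → (p ∧ q) ≤ 𝟘 → Rad x₀ → ¬ F x₀ → F (q ∨ x₀) →
      μ p F ⊆ F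
    μ⊆F-of-disjoint {p} {q} {x₀} p∧q≤𝟘 x₀∈Rad x₀∉F q∨x₀∈F {x} (x∈Rad , p∨x∈F) =
      fromInj₁ (λ x₀∈F → contradiction x₀∈F x₀∉F)
        (prime x x₀ x∈Rad x₀∈Rad (upward (∧-closed _ _ p∨x∈F q∨x₀∈F) bound))
      where
        bound : ((p ∨ x) ∧ (q ∨ x₀)) ≤ (x ∨ x₀)
        bound = ≤-trans (∨∧∨-≤ p q x x₀)
          (∨-least (≤-refl {x ∨ x₀}) (≤-trans p∧q≤𝟘 (𝟘-least (x ∨ x₀))))

    Rad⊆μ-of-complement : ∀ {p q} → p ∨ q ≡ 𝟙 → μ q F ⊆ F → Rad ⊆ μ p F
    Rad⊆μ-of-complement {p} {q} p∨q≡𝟙 μqF⊆F {x} x∈Rad =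
      x∈Rad , μqF⊆F (Rad-upward (y≤x∨y p x) x∈Rad , 𝟙≤⇒∈F 𝟙≤q∨[p∨x])
      where
        𝟙≤q∨[p∨x] : 𝟙 ≤ (q ∨ (p ∨ x))
        𝟙≤q∨[p∨x] = subst (_≤ (q ∨ (p ∨ x))) p∨q≡𝟙
          (∨-least (≤-trans (x≤x∨y p x) (y≤x∨y q (p ∨ x))) (x≤x∨y q (p ∨ x)))

    complementary-dichotomy : ∀ {p q} → p ∨ q ≡ 𝟙 → (p ∧ q) ≤ 𝟘 →
      μ p F ⊆ F ⊎ (μ q F ⊆ F × Rad ⊆ μ p F)
    complementary-dichotomy {p} {q} p∨q≡𝟙 p∧q≤𝟘
      with x₀ , x₀∈Rad , x₀∉F ← proper
      with prime (p ∨ x₀) (q ∨ x₀)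
             (Rad-upward (y≤x∨y p x₀) x₀∈Rad) (Rad-upward (y≤x∨y q x₀) x₀∈Rad)
             (𝟙≤⇒∈F (subst (_≤ ((p ∨ x₀) ∨ (q ∨ x₀))) p∨q≡𝟙
                       (∨-monotonic (x≤x∨y p x₀) (x≤x∨y q x₀))))
    ... | inj₂ q∨x₀∈F = inj₁ (μ⊆F-of-disjoint p∧q≤𝟘 x₀∈Rad x₀∉F q∨x₀∈F)
    ... | inj₁ p∨x₀∈F = inj₂ (μqF⊆F , Rad⊆μ-of-complement p∨q≡𝟙 μqF⊆F)
      where
        μqF⊆F : μ q F ⊆ F
        μqF⊆F = μ⊆F-of-disjoint (subst (_≤ 𝟘) (∧-comm p q) p∧q≤𝟘) x₀∈Rad x₀∉F p∨x₀∈F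

    μ≐F : ∀ {w} → μ w F ⊆ F → μ w F ≐ F
    μ≐F μwF⊆F = ⊆-antisym μwF⊆F F⊆μ

    μ≐Rad : ∀ {w} → Rad ⊆ μ w F → μ w F ≐ Rad
    μ≐Rad Rad⊆μwF = ⊆-antisym proj₁ Rad⊆μwF

    Boolean-dichotomy : ∀ {u} → Bool u → μ u F ⊆ F ⊎ Rad ⊆ μ u F
    Boolean-dichotomy u∈B =
      Sum.map₂ proj₂ (complementary-dichotomy u∈B (complement-disjoint u∈B))

    μ⊆F-∨ : ∀ {u v} → μ u F ⊆ F → μ v F ⊆ F → μ (u ∨ v) F ⊆ F
    μ⊆F-∨ {u} {v} μuF⊆F μvF⊆F {x} (x∈Rad , [u∨v]∨x∈F) =
      μvF⊆F (x∈Rad , μuF⊆F (Rad-upward (y≤x∨y v x) x∈Rad ,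
                            subst F (∨-assoc u v x) [u∨v]∨x∈F))

    Rad⊆μ-∧ : ∀ {u v} → Rad ⊆ μ u F → Rad ⊆ μ v F → Rad ⊆ μ (u ∧ v) F
    Rad⊆μ-∧ {u} {v} Rad⊆μuF Rad⊆μvF {x} x∈Rad =
      x∈Rad , upward (∧-closed _ _ (proj₂ (Rad⊆μuF x∈Rad)) (proj₂ (Rad⊆μvF x∈Rad))) bound
      where
        bound : ((u ∨ x) ∧ (v ∨ x)) ≤ ((u ∧ v) ∨ x)
        bound = ≤-trans (∨∧∨-≤ u v x x)
          (∨-least (∨-least (y≤x∨y (u ∧ v) x) (y≤x∨y (u ∧ v) x)) (x≤x∨y (u ∧ v) x))

    μ-∨-selective : ∀ {u v} → Bool u → Bool v →
      (μ (u ∨ v) F ≐ μ u F) ⊎ (μ (u ∨ v) F ≐ μ v F)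
    μ-∨-selective {u} {v} u∈B v∈B with Boolean-dichotomy u∈B | Boolean-dichotomy v∈B
    ... | inj₂ Rad⊆μuF | _ =
      inj₁ (⊆-antisym (λ h → Rad⊆μuF (proj₁ h)) (μ-monotone (x≤x∨y u v)))
    ... | inj₁ _ | inj₂ Rad⊆μvF =
      inj₂ (⊆-antisym (λ h → Rad⊆μvF (proj₁ h)) (μ-monotone (y≤x∨y u v)))
    ... | inj₁ μuF⊆F | inj₁ μvF⊆F =
      inj₁ (⊆-antisym (λ h → F⊆μ (μ⊆F-∨ μuF⊆F μvF⊆F h)) (μ-monotone (x≤x∨y u v)))

    μ-∧-selective : ∀ {u v} → Bool u → Bool v →
      (μ (u ∧ v) F ≐ μ u F) ⊎ (μ (u ∧ v) F ≐ μ v F)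
    μ-∧-selective {u} {v} u∈B v∈B with Boolean-dichotomy u∈B | Boolean-dichotomy v∈B
    ... | inj₁ μuF⊆F | _ =
      inj₁ (⊆-antisym (μ-monotone (x∧y≤x u v)) (λ h → F⊆μ (μuF⊆F h)))
    ... | inj₂ _ | inj₁ μvF⊆F =
      inj₂ (⊆-antisym (μ-monotone (x∧y≤y u v)) (λ h → F⊆μ (μvF⊆F h)))
    ... | inj₂ Rad⊆μuF | inj₂ Rad⊆μvF =
      inj₁ (⊆-antisym (λ h → Rad⊆μuF (proj₁ h))
                      (λ h → Rad⊆μ-∧ Rad⊆μuF Rad⊆μvF (proj₁ h)))

    μ-or-μ¬-fixes : ∀ {u} → Bool u → (μ u F ≐ F) ⊎ (μ (¬ₐ u) F ≐ F)
    μ-or-μ¬-fixes u∈B =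
      Sum.map μ≐F (λ (μ¬uF⊆F , _) → μ≐F μ¬uF⊆F)
        (complementary-dichotomy u∈B (complement-disjoint u∈B))

    μ-fixes-or-fills : ∀ {u} → Bool u → (μ u F ≐ F) ⊎ (μ u F ≐ Rad)
    μ-fixes-or-fills u∈B = Sum.map μ≐F μ≐Rad (Boolean-dichotomy u∈B)

lemma6p5 : {a : Level} (A : SBPAlgebra a) →
    let open SBPAlgebra A in
    let open SBPNotions A in
    (𝔵 : Subset) → IsGenPrimeFilter 𝔵 →
    (u v : Carrier) → Bool u → Bool v →
      ((μ (u ∨ v) 𝔵 ≐ μ u 𝔵) ⊎ (μ (u ∨ v) 𝔵 ≐ μ v 𝔵))
      × ((μ (u ∧ v) 𝔵 ≐ μ u 𝔵) ⊎ (μ (u ∧ v) 𝔵 ≐ μ v 𝔵))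
      × ((μ u 𝔵 ≐ 𝔵) ⊎ (μ (¬ₐ u) 𝔵 ≐ 𝔵))
      × ((μ u 𝔵 ≐ 𝔵) ⊎ (μ u 𝔵 ≐ Rad))
      × (μ u (μ u 𝔵) ≐ μ u 𝔵)
lemma6p5 A 𝔵 (inj₁ 𝔵-isFilter) u v u∈B v∈B =
  μ-∨-selective u∈B v∈B , μ-∧-selective u∈B v∈B , μ-or-μ¬-fixes u∈B ,
  μ-fixes-or-fills u∈B , μ-idempotent u 𝔵
  where
    open RadicalFilters A
    open ProperPrimeFilter 𝔵-isFilter
lemma6p5 A 𝔵 (inj₂ 𝔵≐Rad) u v _ _ =
  inj₁ μ-constant , inj₁ μ-constant , inj₁ μ-fixes , inj₁ μ-fixes , μ-idempotent u 𝔵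
  where
    open RadicalFilters A
    open RadicalItself 𝔵≐Rad
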